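{- Let $k\ge2$, $m\ge0$, and let $G_1,G_2$ be undirected graphs. If $m$ iterations of $k$-walk refinement distinguish $G_1$ and $G_2$, then a $\mathcal{W}_k$ sentence of quantifier depth $m+1$ (respectively $m+2$ if $k=2$) distinguishes $G_1$ and $G_2$.
   Context: The initial coloring of an undirected graph $G=(V,E)$ is $\chi(v,v)=-1$, $\chi(u,v)=1$ if $u\ne v$, $\{u,v\}\in E$, and $0$ otherwise. The $k$-walk refinement maps $\chi$ to $\chi_{\mathcal{W}[k]}(u,v)=\{\!\{(\chi(u,w_1),\chi(w_1,w_2),\dots,\chi(w_{k-1},v)): w_i\in V\}\!\}$; colors are formal objects, comparable across graphs. $m$ iterations distinguish $G_1,G_2$ if, starting from the initial colorings $\chi_1,\chi_2$, the multisets $\{\!\{(\chi_1)_{\mathcal{W}[k]}^m(u,v): u,v\in V_1\}\!\}$ and $\{\!\{(\chi_2)_{\mathcal{W}[k]}^m(u,v):u,v\in V_2\}\!\}$ differ. The logic $\mathcal{W}_k$ uses $k+1$ variables; formulas with free variables among $z_1,z_{k+1}$ are given by $\varphi(z_1,z_{k+1})::= z_1=z_{k+1}\mid z_1\sim z_{k+1}\mid\varphi\wedge\varphi\mid\neg\varphi\mid\exists^j(z_2,\dots,z_k).\ \bigwedge_{i\in[k]}\varphi_i(z_i,z_{i+1})$ with $z_1,\dots,z_{k+1}$ pairwise distinct variables, each $\varphi_i$ having free variables among $z_i,z_{i+1}$; the walk quantifier holds iff at least $j$ distinct tuples $(v_2,\dots,v_k)$ satisfy the conjunction. A sentence is a formula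 without free variables; quantifier depth is the nesting depth of walk quantifiers; a sentence distinguishes two graphs if it has different truth values on them. -}

module Defs where

open import Level using (0ℓ)
open import Data.Nat using (ℕ; zero; suc; _⊔_)
open import Data.Integer using (ℤ; +_; -[1+_])
open import Data.Bool using (Bool; true; false; if_then_else_)
open import Data.Fin using (Fin; zero; suc; fromℕ; toℕ; _≟_)
open import Data.List using (List; []; _∷_; [_]; _++_; map; concatMap; allFin)
open import Data.List.Relation.Unary.All using (All)
open import Data.List.Relation.Unary.Unique.Propositional using (Unique)
open import Data.Vec using (Vec; lookup)
open import Data.Product using (Σ; _×_; _,_)
open import Data.Sum using (_⊎_)
open import Data.Empty using (⊥)
open import Function.Definitions using (Injective)
open import Relation.Nullary using (¬_; ⌊_⌋)
open import Relation.Binary.PropositionalEquality using (_≡_; _≢_)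
open import Relation.Binary.Bundles using (Setoid)
import Relation.Binary.PropositionalEquality as ≡
import Data.List.Relation.Binary.Pointwise as LPW
import Data.List.Relation.Binary.Permutation.Setoid as Perm

record Graph : Set where
  field
    n      : ℕ
    adj    : Fin n → Fin n → Bool
    sym    : ∀ u v → adj u v ≡ adj v u
    irrefl : ∀ v → adj v v ≡ false
open Graph public

-- Formal colours (comparable across graphs)
-- Colours after m iterations: Col 0 = ℤ (values -1,0,1);
-- Col (m+1) = multisets of tuples of Col m, i.e. lists of lists modulo
-- permutation (of the outer list) and pointwise equality (inner lists).

ColS : ℕ → Setoid 0ℓ 0ℓ
ColS zero    = ≡.setoid ℤ
ColS (suc m) = Perm.↭-setoid (LPW.setoid (ColS m))

Col : ℕ → Set
Col m = Setoid.Carrier (ColS m)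

MSetS : ℕ → Setoid 0ℓ 0ℓ
MSetS m = Perm.↭-setoid (ColS m)

_≈ᴹ_ : ∀ {m} → List (Col m) → List (Col m) → Set
_≈ᴹ_ {m} = Setoid._≈_ (MSetS m)

χ₀ : (G : Graph) → Fin (n G) → Fin (n G) → ℤ
χ₀ G u v with u ≟ v
... | Relation.Nullary.yes _ = -[1+ 0 ]
... | Relation.Nullary.no _  = if adj G u v then + 1 else + 0

tuples : ∀ n → ℕ → List (List (Fin n))
tuples n zero    = [ [] ]
tuples n (suc j) = concatMap (λ v → map (v ∷_) (tuples n j)) (allFin n)

walkCols : ∀ {n} {A : Set} → (Fin n → Fin n → A) → List (Fin n) → List A
walkCols χ []           = []
walkCols χ (x ∷ [])     = []
walkCols χ (x ∷ y ∷ xs) = χ x y ∷ walkCols χ (y ∷ xs)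

walkRefine : ∀ {n} {A : Set} (k : ℕ) → (Fin n → Fin n → A) →
             Fin n → Fin n → List (List A)
walkRefine {n} k χ u v =
  map (λ ws → walkCols χ (u ∷ ws ++ [ v ])) (tuples n (k Data.Nat.∸ 1))

iterW : (k : ℕ) (G : Graph) (m : ℕ) → Fin (n G) → Fin (n G) → Col m
iterW k G zero    = χ₀ G
iterW k G (suc m) = walkRefine k (iterW k G m)

pairColours : (k : ℕ) (G : Graph) (m : ℕ) → List (Col m)
pairColours k G m =
  concatMap (λ u → map (λ v → iterW k G m u v) (allFin (n G))) (allFin (n G))

WalkDistinguishes : (k m : ℕ) (G₁ G₂ : Graph) → Set
WalkDistinguishes k m G₁ G₂ = ¬ (_≈ᴹ_ {m} (pairColours k G₁ m) (pairColours k G₂ m))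

Var : ℕ → Set
Var k = Fin (suc k)

data Form (k : ℕ) : Set where
  _≐_   : Var k → Var k → Form k
  _∼_   : Var k → Var k → Form k
  _∧_   : Form k → Form k → Form k
  ¬ᶠ_   : Form k → Form k
  -- ∃^j (x₂,…,x_k). ⋀_{i ∈ [k]} φ_i(x_i, x_{i+1})
  -- xs i is the variable x_{i+1}; φs i is the conjunct φ_{i+1}
  ∃walk : ℕ → (Fin (suc k) → Var k) → (Fin k → Form k) → Form k

Interior : ∀ {k} → Fin (suc k) → Set
Interior {k} i = (toℕ i ≢ 0) × (toℕ i ≢ k)

Free : ∀ {k} → Form k → Var k → Set
Free (x ≐ y) z = (z ≡ x) ⊎ (z ≡ y)
Free (x ∼ y) z = (z ≡ x) ⊎ (z ≡ y)
Free (φ ∧ ψ) z = Free φ z ⊎ Free ψ z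
Free (¬ᶠ φ)  z = Free φ z
Free {k} (∃walk j xs φs) z =
  Σ (Fin k) (λ i → Free (φs i) z) ×
  ¬ Σ (Fin (suc k)) (λ i → Interior i × (z ≡ xs i))

WF : ∀ {k} → Form k → Set
WF (x ≐ y) = Data.Unit.⊤
  where import Data.Unit
WF (x ∼ y) = Data.Unit.⊤
  where import Data.Unit
WF (φ ∧ ψ) = WF φ × WF ψ
WF (¬ᶠ φ)  = WF φ
WF {k} (∃walk j xs φs) =
  Injective _≡_ _≡_ xs ×
  ((i : Fin k) → ∀ z → Free (φs i) z →
      (z ≡ xs (Data.Fin.inject₁ i)) ⊎ (z ≡ xs (suc i))) ×
  ((i : Fin k) → WF (φs i))

Sentence : ∀ {k} → Form k → Set
Sentence φ = WF φ × (∀ z → ¬ Free φ z)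

maxF : ∀ {k} → (Fin k → ℕ) → ℕ
maxF {zero}  f = 0
maxF {suc k} f = f zero ⊔ maxF (λ i → f (suc i))

qd : ∀ {k} → Form k → ℕ
qd (x ≐ y)         = 0
qd (x ∼ y)         = 0
qd (φ ∧ ψ)         = qd φ ⊔ qd ψ
qd (¬ᶠ φ)          = qd φ
qd (∃walk j xs φs) = suc (maxF (λ i → qd (φs i)))

-- simultaneous update of an assignment: xs i ↦ w i (first match wins)
updAll : ∀ {k N m} → (Fin m → Var k) → (Fin m → Fin N) →
         (Var k → Fin N) → (Var k → Fin N)
updAll {m = zero}  xs w a z = a z
updAll {m = suc m} xs w a z =
  if ⌊ z ≟ xs zero ⌋ then w zero else updAll (λ i → xs (suc i)) (λ i → w (suc i)) a z

Sat : ∀ {k} (G : Graph) → Form k → (Var k → Fin (n G)) → Set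
Sat G (x ≐ y) a = a x ≡ a y
Sat G (x ∼ y) a = adj G (a x) (a y) ≡ true
Sat G (φ ∧ ψ) a = Sat G φ a × Sat G ψ a
Sat G (¬ᶠ φ)  a = ¬ Sat G φ a
Sat {k} G (∃walk j xs φs) a =
  -- at least j distinct tuples (v₂,…,v_k); a tuple is represented by the
  -- whole walk (v₁,…,v_{k+1}) with v₁ = a(x₁), v_{k+1} = a(x_{k+1}) fixed
  Σ (List (Vec (Fin (n G)) (suc k))) λ ws →
    (j Data.Nat.≤ Data.List.length ws) × Unique ws ×
    All (λ w → (lookup w zero ≡ a (xs zero)) ×
               (lookup w (fromℕ k) ≡ a (xs (fromℕ k))) ×
               ((i : Fin k) → Sat G (φs i) (updAll xs (lookup w) a))) ws

Models : ∀ {k} (G : Graph) → Form k → Set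
Models G φ = (a : Var _ → Fin (n G)) → Sat G φ a

Distinguishes : ∀ {k} → Form k → Graph → Graph → Set
Distinguishes φ G₁ G₂ = ¬ ((Models G₁ φ → Models G₂ φ) × (Models G₂ φ → Models G₁ φ))

targetDepth : ℕ → ℕ → ℕ
targetDepth (suc (suc zero)) m = suc (suc m)
targetDepth _                m = suc m

-- Every colour class c of m rounds of k-walk refinement on G₁ and G₂ is defined by a formula φ_c(x, y) of
-- quantifier depth m.  The colour after one more round is the multiset of the step-colour sequences of the
-- walks from x to y; since only finitely many sequences occur in the two graphs, that multiset is fixed by
-- finitely many statements "exactly N walks x = z₁, …, z_{k+1} = y satisfy φ_{c₁}(z₁, z₂) ∧ … ∧ φ_{c_k}(z_k, z_{k+1})".
-- If m rounds distinguish the graphs, some colour c is carried by different numbers of pairs.  For k ≥ 3 a single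
-- walk quantifier counts these pairs: with φ_c(z₂, z₃) and z₃ = … = z_k its witnesses are exactly the pairs of
-- colour c.  For k = 2 a walk has one interior vertex only, so one counts the vertices p having at least j
-- partners q with (p, q) of colour c; as these counts sum over j to the number of pairs of colour c, some j
-- separates the graphs, at the price of one more quantifier.  Conjoining a trivially true sentence makes the
-- depth exact, and negating turns "true in G₁, false in G₂" into a distinguishing sentence when G₂ is empty.

module Submission where

open import Defs hiding (sym)
open import Level using (0ℓ)
open import Data.Bool using (true; false)
open import Data.Empty using (⊥-elim)
open import Data.Fin using (Fin; zero; suc; fromℕ; inject₁; toℕ)
import Data.Fin.Properties as Fin
open import Data.Fin.Permutation.Components using (transpose; transpose-inverse)
import Data.Integer as ℤ
open import Data.List
  using (List; []; _∷_; [_]; _++_; map; concatMap; allFin; length; tabulate; filter; cartesianProductWith)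
open import Data.List.Properties using (length-++-sucʳ; map-∘; map-cong; concatMap-cong; map-concatMap)
open import Data.List.Membership.Propositional using (_∈_; find)
open import Data.List.Membership.Propositional.Properties
  using (∈-∃++; ∈-++⁺ˡ; ∈-++⁺ʳ; ∈-++⁻; ∈-map⁺; ∈-map⁻; ∈-allFin; ∈-concat⁺′; ∈-concat⁻′; ∈-filter⁺; ∈-filter⁻)
import Data.List.Relation.Binary.Pointwise as LPW
open import Data.List.Relation.Binary.Pointwise using (Pointwise; []; _∷_)
open import Data.List.Relation.Binary.Subset.Propositional using (_⊆_)
open import Data.List.Relation.Unary.All as All using (All; []; _∷_)
open import Data.List.Relation.Unary.All.Properties as AllP using (¬Any⇒All¬; ¬All⇒Any¬)
open import Data.List.Relation.Unary.AllPairs using ([]; _∷_)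
open import Data.List.Relation.Unary.Any using (here; there; any?)
open import Data.List.Relation.Unary.Unique.Propositional using (Unique)
import Data.List.Relation.Unary.Unique.Propositional.Properties as UniqueP
import Data.Nat as ℕ
open import Data.Nat using (ℕ; zero; suc; _+_; _*_; _≤_; _<_; _⊔_; _⊓_; _≤?_; z≤n; s≤s)
open import Data.Nat.Properties
  using ( module ≤-Reasoning; +-0-commutativeMonoid; suc-injective
        ; ≤-refl; ≤-trans; ≤-antisym; ≤-<-trans; <-cmp; <⇒≱; ≮⇒≥; n≮n; n≤0⇒n≡0; m≤n⇒m≤1+n; m≤m+n; m≤n+m
        ; +-assoc; +-identityʳ; +-cancelˡ-≡; *-identityʳ
        ; ⊔-lub; ⊔-identityʳ; ⊔-idem; m≤n⇒m⊔n≡n; m≥n⇒m⊓n≡n )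
open import Algebra.Properties.CommutativeMonoid.Sum +-0-commutativeMonoid
  using (sum-syntax; sum-cong-≗; sum-replicate-zero; ∑-comm)
open import Data.Product using (Σ; ∃; _×_; _,_; proj₁; proj₂)
open import Data.Sum using (_⊎_; inj₁; inj₂; reduce) renaming ([_,_] to [_,_]′)
open import Data.Unit using (⊤; tt)
open import Data.Vec using (Vec; []; _∷_; _∷ʳ_; lookup; toList; initLast)
import Data.Vec.Properties as Vec
open import Function using (_∘_; id)
open import Function.Bundles using (_⇔_; mk⇔; Equivalence)
open import Function.Definitions using (Injective)
open import Function.Properties.Equivalence using () renaming (sym to ⇔-sym; trans to ⇔-trans)
open import Relation.Binary.Bundles using (Setoid)
open import Relation.Binary.Definitions using (tri<; tri≈; tri>)
import Relation.Binary.Definitions as B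
open import Relation.Binary.PropositionalEquality
  using (_≡_; _≢_; refl; sym; trans; cong; cong₂; subst; subst₂; module ≡-Reasoning)
open import Relation.Nullary using (¬_; Dec; yes; no)
import Relation.Nullary.Decidable as Dec
open import Relation.Unary using (Pred; Decidable)

open Equivalence using (to; from)

∀-cong-⇔ : ∀ {I : Set} {P Q : I → Set} → (∀ i → P i ⇔ Q i) → (∀ i → P i) ⇔ (∀ i → Q i)
∀-cong-⇔ P⇔Q = mk⇔ (λ p i → to (P⇔Q i) (p i)) (λ q i → from (P⇔Q i) (q i))

⇔-resp-≡₂ : ∀ {P A B : Set} (R : A → B → Set) {x x′ y y′} → x ≡ x′ → y ≡ y′ → P ⇔ R x y → P ⇔ R x′ y′
⇔-resp-≡₂ R refl refl P⇔R = P⇔R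

All-cong-⇔ : ∀ {A : Set} {P Q : Pred A 0ℓ} → (∀ x → P x ⇔ Q x) → ∀ {xs} → All P xs ⇔ All Q xs
All-cong-⇔ P⇔Q = mk⇔ (All.map (to (P⇔Q _))) (All.map (from (P⇔Q _)))

All-map-⇔ : ∀ {A B : Set} {P : Pred B 0ℓ} (f : A → B) {xs} → All P (map f xs) ⇔ All (P ∘ f) xs
All-map-⇔ f = mk⇔ AllP.map⁻ AllP.map⁺

𝟙 : {P : Set} → Dec P → ℕ
𝟙 (yes _) = 1
𝟙 (no _)  = 0

𝟙-cong : {P Q : Set} → P ⇔ Q → (p? : Dec P) (q? : Dec Q) → 𝟙 p? ≡ 𝟙 q?
𝟙-cong P⇔Q (yes p) (yes q) = refl
𝟙-cong P⇔Q (yes p) (no ¬q) = ⊥-elim (¬q (to P⇔Q p))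
𝟙-cong P⇔Q (no ¬p) (yes q) = ⊥-elim (¬p (from P⇔Q q))
𝟙-cong P⇔Q (no ¬p) (no ¬q) = refl

module _ {A : Set} where

  count : {P : Pred A 0ℓ} → Decidable P → List A → ℕ
  count P? []       = 0
  count P? (x ∷ xs) = 𝟙 (P? x) + count P? xs

  count-cong : {P Q : Pred A 0ℓ} (P? : Decidable P) (Q? : Decidable Q) →
               (∀ x → P x ⇔ Q x) → ∀ xs → count P? xs ≡ count Q? xs
  count-cong P? Q? P⇔Q []       = refl
  count-cong P? Q? P⇔Q (x ∷ xs) = cong₂ _+_ (𝟙-cong (P⇔Q x) (P? x) (Q? x)) (count-cong P? Q? P⇔Q xs)

  count-none : {P : Pred A 0ℓ} (P? : Decidable P) → ∀ xs → All (λ x → ¬ P x) xs → count P? xs ≡ 0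
  count-none P? []       []         = refl
  count-none P? (x ∷ xs) (¬px ∷ ¬P) with P? x
  ... | yes px = ⊥-elim (¬px px)
  ... | no _   = count-none P? xs ¬P

  count-++ : {P : Pred A 0ℓ} (P? : Decidable P) → ∀ xs ys → count P? (xs ++ ys) ≡ count P? xs + count P? ys
  count-++ P? []       ys = refl
  count-++ P? (x ∷ xs) ys = trans (cong (𝟙 (P? x) +_) (count-++ P? xs ys)) (sym (+-assoc (𝟙 (P? x)) _ _))

  length-filter : {P : Pred A 0ℓ} (P? : Decidable P) → ∀ xs → length (filter P? xs) ≡ count P? xs
  length-filter P? []       = refl
  length-filter P? (x ∷ xs) with P? x
  ... | yes _ = cong suc (length-filter P? xs)
  ... | no _  = length-filter P? xs

  Unique-⊆⇒length≤ : ∀ {xs ys : List A} → Unique xs → xs ⊆ ys → length xs ≤ length ys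
  Unique-⊆⇒length≤ {[]}     _               _   = z≤n
  Unique-⊆⇒length≤ {x ∷ xs} (x∉xs ∷ unique) x∷xs⊆ys
    with ys₁ , ys₂ , refl ← ∈-∃++ (x∷xs⊆ys (here refl))
    = subst (suc (length xs) ≤_) (sym (length-++-sucʳ ys₁ x ys₂)) (s≤s (Unique-⊆⇒length≤ unique xs⊆))
    where
    xs⊆ : xs ⊆ ys₁ ++ ys₂
    xs⊆ {y} y∈xs with ∈-++⁻ ys₁ (x∷xs⊆ys (there y∈xs))
    ... | inj₁ y∈ys₁         = ∈-++⁺ˡ y∈ys₁
    ... | inj₂ (here refl)   = ⊥-elim (All.lookup x∉xs y∈xs refl)
    ... | inj₂ (there y∈ys₂) = ∈-++⁺ʳ ys₁ y∈ys₂

module _ {B : Set} {P : Pred B 0ℓ} (P? : Decidable P) where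

  count-tabulate : ∀ {n} (f : Fin n → B) → count P? (tabulate f) ≡ ∑[ i < n ] 𝟙 (P? (f i))
  count-tabulate {zero}  f = refl
  count-tabulate {suc n} f = cong (𝟙 (P? (f zero)) +_) (count-tabulate (λ i → f (suc i)))

module _ {A B : Set} {P : Pred B 0ℓ} (P? : Decidable P) where

  count-map : (f : A → B) → ∀ xs → count P? (map f xs) ≡ count (λ x → P? (f x)) xs
  count-map f []       = refl
  count-map f (x ∷ xs) = cong (𝟙 (P? (f x)) +_) (count-map f xs)

  count-concatMap : (g : A → List B) → ∀ {n} (f : Fin n → A) →
                    count P? (concatMap g (tabulate f)) ≡ ∑[ i < n ] count P? (g (f i))
  count-concatMap g {zero}  f = refl
  count-concatMap g {suc n} f = trans (count-++ P? (g (f zero)) _)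
                                      (cong (count P? (g (f zero)) +_) (count-concatMap g (λ i → f (suc i))))

∑-𝟙-≟ : ∀ {N} (p : Fin N) → ∑[ a < N ] 𝟙 (p Fin.≟ a) ≡ 1
∑-𝟙-≟ {suc N} zero    = cong suc (sum-replicate-zero N)
∑-𝟙-≟ {suc N} (suc p) =
  trans (sum-cong-≗ (λ a → 𝟙-cong (mk⇔ Fin.suc-injective (cong suc)) (suc p Fin.≟ suc a) (p Fin.≟ a))) (∑-𝟙-≟ p)

∑-𝟙≤ : ∀ {N} {P : Pred (Fin N) 0ℓ} (P? : Decidable P) → ∑[ i < N ] 𝟙 (P? i) ≤ N
∑-𝟙≤ {zero}  P? = z≤n
∑-𝟙≤ {suc N} P? with P? zero
... | yes _ = s≤s (∑-𝟙≤ (P? ∘ suc))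
... | no _  = m≤n⇒m≤1+n (∑-𝟙≤ (P? ∘ suc))

∑-𝟙-suc≤? : ∀ B r → ∑[ i < B ] 𝟙 (suc (toℕ i) ≤? r) ≡ B ⊓ r
∑-𝟙-suc≤? zero    r       = refl
∑-𝟙-suc≤? (suc B) zero    = sum-replicate-zero B
∑-𝟙-suc≤? (suc B) (suc r) =
  cong suc (trans (sum-cong-≗ {B} (λ i → 𝟙-cong (mk⇔ ℕ.s≤s⁻¹ s≤s) (suc (suc (toℕ i)) ≤? suc r) (suc (toℕ i) ≤? r)))
                  (∑-𝟙-suc≤? B r))

∑≢⇒≢ : ∀ {N} (f g : Fin N → ℕ) → ∑[ i < N ] f i ≢ ∑[ i < N ] g i → ∃ λ i → f i ≢ g i
∑≢⇒≢ {zero}  f g ∑f≢∑g = ⊥-elim (∑f≢∑g refl)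
∑≢⇒≢ {suc N} f g ∑f≢∑g with f zero ℕ.≟ g zero
... | no f0≢g0 = zero , f0≢g0
... | yes f0≡g0 with i , fi≢gi ← ∑≢⇒≢ (f ∘ suc) (g ∘ suc) (∑f≢∑g ∘ cong₂ _+_ f0≡g0) = suc i , fi≢gi

0<∑⇒Fin : ∀ {N} (f : Fin N → ℕ) → 0 < ∑[ i < N ] f i → Fin N
0<∑⇒Fin {suc N} f _ = zero

module Multiplicity (S : Setoid 0ℓ 0ℓ) (_≈?_ : B.Decidable (Setoid._≈_ S)) where

  open Setoid S using (_≈_) renaming (Carrier to A; refl to ≈-refl; sym to ≈-sym; trans to ≈-trans)
  open import Data.List.Relation.Binary.Permutation.Setoid S
    using (_↭_; prep; ↭-refl; ↭-sym; ↭-trans; ↭-prep; ↭-swap)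
  open import Data.List.Relation.Binary.Permutation.Setoid.Properties S
    using (xs↭ys⇒|xs|≡|ys|; filter⁺)

  multiplicity : A → List A → ℕ
  multiplicity z = count (_≈? z)

  private
    𝟙-resp-≈ : ∀ {x y z} → x ≈ y → 𝟙 (x ≈? z) ≡ 𝟙 (y ≈? z)
    𝟙-resp-≈ x≈y = 𝟙-cong (mk⇔ (≈-trans (≈-sym x≈y)) (≈-trans x≈y)) _ _

    multiplicity-∷-pos : ∀ x L → 0 < multiplicity x (x ∷ L)
    multiplicity-∷-pos x L with x ≈? x
    ... | yes _  = s≤s z≤n
    ... | no x≉x = ⊥-elim (x≉x ≈-refl)

  multiplicity-resp-≈ : ∀ {z z′} → z ≈ z′ → ∀ L → multiplicity z L ≡ multiplicity z′ L
  multiplicity-resp-≈ z≈z′ = count-cong _ _ (λ x → mk⇔ (λ x≈z → ≈-trans x≈z z≈z′) (λ x≈z′ → ≈-trans x≈z′ (≈-sym z≈z′)))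

  multiplicity-resp-↭ : ∀ z {L M} → L ↭ M → multiplicity z L ≡ multiplicity z M
  multiplicity-resp-↭ z {L} {M} L↭M = begin
    multiplicity z L           ≡⟨ length-filter (_≈? z) L ⟨
    length (filter (_≈? z) L)  ≡⟨ xs↭ys⇒|xs|≡|ys| (filter⁺ (_≈? z) (λ x≈y x≈z → ≈-trans (≈-sym x≈y) x≈z) L↭M) ⟩
    length (filter (_≈? z) M)  ≡⟨ length-filter (_≈? z) M ⟩
    multiplicity z M           ∎
    where open ≡-Reasoning

  ↭-pick : ∀ x M → 0 < multiplicity x M → ∃ λ y → ∃ λ M′ → y ≈ x × M ↭ y ∷ M′
  ↭-pick x (y ∷ M) pos with y ≈? x
  ... | yes y≈x = y , M , y≈x , ↭-refl
  ... | no _ with y′ , M′ , y′≈x , M↭ ← ↭-pick x M pos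
    = y′ , y ∷ M′ , y′≈x , ↭-trans (↭-prep y M↭) (↭-swap y y′ ↭-refl)

  multiplicity≡⇒↭ : ∀ L M → (∀ z → multiplicity z L ≡ multiplicity z M) → L ↭ M
  multiplicity≡⇒↭ [] [] _ = ↭-refl
  multiplicity≡⇒↭ [] (y ∷ M) same with y ≈? y | same y
  ... | yes _  | ()
  ... | no y≉y | _ = ⊥-elim (y≉y ≈-refl)
  multiplicity≡⇒↭ (x ∷ L) M same
    with y , M′ , y≈x , M↭ ← ↭-pick x M (subst (0 <_) (same x) (multiplicity-∷-pos x L))
    = ↭-trans (prep (≈-sym y≈x) (multiplicity≡⇒↭ L M′ same′)) (↭-sym M↭)
    where
    same′ : ∀ z → multiplicity z L ≡ multiplicity z M′
    same′ z = +-cancelˡ-≡ (𝟙 (x ≈? z)) _ _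
      (trans (same z) (trans (multiplicity-resp-↭ z M↭) (cong (_+ multiplicity z M′) (𝟙-resp-≈ y≈x))))

  SameMultiplicities : List A → List A → Set
  SameMultiplicities L M = All (λ z → multiplicity z L ≡ multiplicity z M) (L ++ M)

  SameMultiplicities⇒multiplicity≡ : ∀ L M → SameMultiplicities L M → ∀ z → multiplicity z L ≡ multiplicity z M
  SameMultiplicities⇒multiplicity≡ L M same z with any? (_≈? z) (L ++ M)
  ... | yes x≈z∈ with x≈z ← All.lookupAny same x≈z∈ =
    trans (multiplicity-resp-≈ (≈-sym (proj₂ x≈z)) L) (trans (proj₁ x≈z) (multiplicity-resp-≈ (proj₂ x≈z) M))
  ... | no z∉ with z∉L , z∉M ← AllP.++⁻ L (¬Any⇒All¬ (L ++ M) z∉) =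
    trans (count-none (_≈? z) L z∉L) (sym (count-none (_≈? z) M z∉M))

  ↭⇔SameMultiplicities : ∀ L M → (L ↭ M) ⇔ SameMultiplicities L M
  ↭⇔SameMultiplicities L M = mk⇔
    (λ L↭M → All.tabulate (λ {z} _ → multiplicity-resp-↭ z L↭M))
    (λ same → multiplicity≡⇒↭ L M (SameMultiplicities⇒multiplicity≡ L M same))

  _↭?_ : ∀ L M → Dec (L ↭ M)
  L ↭? M = Dec.map′ (from (↭⇔SameMultiplicities L M)) (to (↭⇔SameMultiplicities L M))
                    (All.all? (λ z → multiplicity z L ℕ.≟ multiplicity z M) (L ++ M))

  ¬↭⇒multiplicity≢ : ∀ L M → ¬ (L ↭ M) → ∃ λ z → z ∈ L ++ M × multiplicity z L ≢ multiplicity z M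
  ¬↭⇒multiplicity≢ L M L≁M = find (¬All⇒Any¬ (λ z → multiplicity z L ℕ.≟ multiplicity z M) (L ++ M)
                                              (L≁M ∘ from (↭⇔SameMultiplicities L M)))

ColEq : ∀ m → Col m → Col m → Set
ColEq m = Setoid._≈_ (ColS m)

syntax ColEq m c c′ = c ≈[ m ] c′

ColEq? : ∀ m → B.Decidable (ColEq m)
ColEq? zero    = ℤ._≟_
ColEq? (suc m) = Multiplicity._↭?_ (LPW.setoid (ColS m)) (LPW.decidable (ColEq? m))

syntax ColEq? m c c′ = c ≟[ m ] c′

module _ {n : ℕ} where

  allVecs : ∀ j → List (Vec (Fin n) j)
  allVecs zero    = [ [] ]
  allVecs (suc j) = concatMap (λ a → map (a ∷_) (allVecs j)) (allFin n)

  ∈-allVecs : ∀ {j} (v : Vec (Fin n) j) → v ∈ allVecs j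
  ∈-allVecs []      = here refl
  ∈-allVecs (a ∷ v) = ∈-concat⁺′ (∈-map⁺ (a ∷_) (∈-allVecs v)) (∈-map⁺ _ (∈-allFin a))

  allVecs-unique : ∀ j → Unique (allVecs j)
  allVecs-unique zero    = [] ∷ []
  allVecs-unique (suc j) =
    subst Unique (concatMap≡cartesianProductWith (allFin n))
          (UniqueP.cartesianProductWith⁺ _∷_ Vec.∷-injective (UniqueP.allFin⁺ n) (allVecs-unique j))
    where
    concatMap≡cartesianProductWith : ∀ as →
      cartesianProductWith _∷_ as (allVecs j) ≡ concatMap (λ a → map (a ∷_) (allVecs j)) as
    concatMap≡cartesianProductWith []       = refl
    concatMap≡cartesianProductWith (a ∷ as) = cong (map (a ∷_) (allVecs j) ++_) (concatMap≡cartesianProductWith as)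

  tuples≡map-toList-allVecs : ∀ j → tuples n j ≡ map toList (allVecs j)
  tuples≡map-toList-allVecs zero    = refl
  tuples≡map-toList-allVecs (suc j) = begin
    concatMap (λ a → map (a ∷_) (tuples n j)) (allFin n)
      ≡⟨ concatMap-cong (λ a → cong (map (a ∷_)) (tuples≡map-toList-allVecs j)) (allFin n) ⟩
    concatMap (λ a → map (a ∷_) (map toList (allVecs j))) (allFin n)
      ≡⟨ concatMap-cong (λ a → trans (sym (map-∘ (allVecs j))) (map-∘ (allVecs j))) (allFin n) ⟩
    concatMap (λ a → map toList (map (a ∷_) (allVecs j))) (allFin n)
      ≡⟨ map-concatMap toList (λ a → map (a ∷_) (allVecs j)) (allFin n) ⟨
    map toList (allVecs (suc j))
      ∎
    where open ≡-Reasoning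

  lookup-∷ʳ-last : ∀ {j} (v : Vec (Fin n) j) y → lookup (v ∷ʳ y) (fromℕ j) ≡ y
  lookup-∷ʳ-last []      y = refl
  lookup-∷ʳ-last (x ∷ v) y = lookup-∷ʳ-last v y

  -- a walk with j interior vertices, as the vector of its j + 2 vertices
  walks : ∀ j → Fin n → Fin n → List (Vec (Fin n) (suc (suc j)))
  walks j u v = map (λ mid → u ∷ (mid ∷ʳ v)) (allVecs j)

  ∈-walks⁺ : ∀ {j u v} (w : Vec (Fin n) (suc (suc j))) →
             lookup w zero ≡ u → lookup w (fromℕ (suc j)) ≡ v → w ∈ walks j u v
  ∈-walks⁺ (u ∷ w) refl refl with mid , y , refl ← initLast w
    rewrite lookup-∷ʳ-last mid y = ∈-map⁺ _ (∈-allVecs mid)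

  ∈-walks⁻ : ∀ {j u v} {w : Vec (Fin n) (suc (suc j))} → w ∈ walks j u v →
             lookup w zero ≡ u × lookup w (fromℕ (suc j)) ≡ v
  ∈-walks⁻ {u = u} {v} w∈ with mid , _ , refl ← ∈-map⁻ (λ mid → u ∷ (mid ∷ʳ v)) w∈ = refl , lookup-∷ʳ-last mid v

  walks-unique : ∀ j u v → Unique (walks j u v)
  walks-unique j u v =
    UniqueP.map⁺ (λ {x} {y} eq → Vec.∷ʳ-injectiveˡ x y (proj₂ (Vec.∷-injective eq))) (allVecs-unique j)

  walkRefine≡map-walks : ∀ {A : Set} j (χ : Fin n → Fin n → A) u v →
                         walkRefine (suc j) χ u v ≡ map (walkCols χ ∘ toList) (walks j u v)
  walkRefine≡map-walks j χ u v = begin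
    map (λ ws → walkCols χ (u ∷ ws ++ [ v ])) (tuples n j)
      ≡⟨ cong (map _) (tuples≡map-toList-allVecs j) ⟩
    map (λ ws → walkCols χ (u ∷ ws ++ [ v ])) (map toList (allVecs j))
      ≡⟨ map-∘ (allVecs j) ⟨
    map (λ mid → walkCols χ (u ∷ toList mid ++ [ v ])) (allVecs j)
      ≡⟨ map-cong (λ mid → cong (walkCols χ ∘ (u ∷_)) (Vec.toList-∷ʳ v mid)) (allVecs j) ⟨
    map (λ mid → walkCols χ (toList (u ∷ (mid ∷ʳ v)))) (allVecs j)
      ≡⟨ map-∘ (allVecs j) ⟩
    map (walkCols χ ∘ toList) (walks j u v)
      ∎
    where open ≡-Reasoning

  Edgewise : ∀ {k} → (Fin k → Fin n → Fin n → Set) → Vec (Fin n) (suc k) → Set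
  Edgewise R w = ∀ i → R i (lookup w (inject₁ i)) (lookup w (suc i))

  Edgewise? : ∀ {k} {R : Fin k → Fin n → Fin n → Set} → (∀ i → B.Decidable (R i)) → Decidable (Edgewise R)
  Edgewise? R? w = Fin.all? (λ i → R? i _ _)

  Edgewise-∷ : ∀ {k} (R : Fin (suc k) → Fin n → Fin n → Set) u a (w : Vec (Fin n) k) →
               Edgewise R (u ∷ a ∷ w) ⇔ (R zero u a × Edgewise (R ∘ suc) (a ∷ w))
  Edgewise-∷ R u a w = mk⇔ (λ e → e zero , e ∘ suc) (λ { (r , e) zero → r ; (r , e) (suc i) → e i })

  -- the (u, v) entry of the product of the 0/1 matrices of the relations R i
  walkCount : ∀ j (R : Fin (suc j) → Fin n → Fin n → Set) → (∀ i → B.Decidable (R i)) → Fin n → Fin n → ℕ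
  walkCount zero    R R? u v = 𝟙 (R? zero u v)
  walkCount (suc j) R R? u v = ∑[ a < n ] (𝟙 (R? zero u a) * walkCount j (R ∘ suc) (R? ∘ suc) a v)

  count-walks : ∀ j (R : Fin (suc j) → Fin n → Fin n → Set) (R? : ∀ i → B.Decidable (R i))
                (E? : Decidable (Edgewise R)) u v → count E? (walks j u v) ≡ walkCount j R R? u v
  count-walks zero R R? E? u v =
    trans (+-identityʳ _) (𝟙-cong (mk⇔ (λ e → e zero) (λ { r zero → r })) (E? (u ∷ v ∷ [])) (R? zero u v))
  count-walks (suc j) R R? E? u v = begin
    count E? (walks (suc j) u v)
      ≡⟨ count-map E? _ (allVecs (suc j)) ⟩
    count (λ mid → E? (u ∷ (mid ∷ʳ v))) (allVecs (suc j))
      ≡⟨ count-concatMap (λ mid → E? (u ∷ (mid ∷ʳ v))) (λ a → map (a ∷_) (allVecs j)) id ⟩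
    ∑[ a < n ] count (λ mid → E? (u ∷ (mid ∷ʳ v))) (map (a ∷_) (allVecs j))
      ≡⟨ sum-cong-≗ step ⟩
    walkCount (suc j) R R? u v
      ∎
    where
    open ≡-Reasoning
    step : ∀ a → count (λ mid → E? (u ∷ (mid ∷ʳ v))) (map (a ∷_) (allVecs j))
                 ≡ 𝟙 (R? zero u a) * walkCount j (R ∘ suc) (R? ∘ suc) a v
    step a with R? zero u a
    ... | yes r = begin
      count (λ mid → E? (u ∷ (mid ∷ʳ v))) (map (a ∷_) (allVecs j))
        ≡⟨ count-map (λ mid → E? (u ∷ (mid ∷ʳ v))) (a ∷_) (allVecs j) ⟩
      count (λ mid → E? (u ∷ a ∷ (mid ∷ʳ v))) (allVecs j)
        ≡⟨ count-cong _ _ (λ mid → let E∷ = Edgewise-∷ R u a (mid ∷ʳ v) in mk⇔ (proj₂ ∘ to E∷) (λ e → from E∷ (r , e)))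
                      (allVecs j) ⟩
      count (λ mid → Edgewise? (R? ∘ suc) (a ∷ (mid ∷ʳ v))) (allVecs j)
        ≡⟨ count-map (Edgewise? (R? ∘ suc)) _ (allVecs j) ⟨
      count (Edgewise? (R? ∘ suc)) (walks j a v)
        ≡⟨ count-walks j (R ∘ suc) (R? ∘ suc) (Edgewise? (R? ∘ suc)) a v ⟩
      walkCount j (R ∘ suc) (R? ∘ suc) a v
        ≡⟨ +-identityʳ _ ⟨
      1 * walkCount j (R ∘ suc) (R? ∘ suc) a v
        ∎
    ... | no ¬r = trans (count-map (λ mid → E? (u ∷ (mid ∷ʳ v))) (a ∷_) (allVecs j))
                        (count-none _ (allVecs j) (All.universal (λ mid e → ¬r (e zero)) (allVecs j)))

Pointwise-walkCols⇔ : ∀ {n n′} {A B : Set} (R : A → B → Set) (χ : Fin n → Fin n → A) (χ′ : Fin n′ → Fin n′ → B)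
                      {k} (w : Vec (Fin n) (suc k)) (w′ : Vec (Fin n′) (suc k)) →
                      Pointwise R (walkCols χ (toList w)) (walkCols χ′ (toList w′)) ⇔
                      (∀ i → R (χ (lookup w (inject₁ i)) (lookup w (suc i)))
                               (χ′ (lookup w′ (inject₁ i)) (lookup w′ (suc i))))
Pointwise-walkCols⇔ R χ χ′ {zero}  (_ ∷ []) (_ ∷ []) = mk⇔ (λ _ ()) (λ _ → [])
Pointwise-walkCols⇔ R χ χ′ {suc k} (a ∷ b ∷ w) (a′ ∷ b′ ∷ w′) = mk⇔
  (λ { (r ∷ rs) zero → r ; (r ∷ rs) (suc i) → to rest rs i })
  (λ rs → rs zero ∷ from rest (rs ∘ suc))
  where rest = Pointwise-walkCols⇔ R χ χ′ (b ∷ w) (b′ ∷ w′)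

updAll-injective : ∀ {k N m} (xs : Fin m → Var k) (w : Fin m → Fin N) (a : Var k → Fin N) →
                   Injective _≡_ _≡_ xs → ∀ i → updAll xs w a (xs i) ≡ w i
updAll-injective {m = suc m} xs w a xs-inj i with xs i Fin.≟ xs zero
... | yes xsi≡xs0 = cong w (sym (xs-inj xsi≡xs0))
updAll-injective {m = suc m} xs w a xs-inj zero    | no xs0≢xs0 = ⊥-elim (xs0≢xs0 refl)
updAll-injective {m = suc m} xs w a xs-inj (suc i) | no _ =
  updAll-injective (xs ∘ suc) (w ∘ suc) a (Fin.suc-injective ∘ xs-inj) i

Sat-∃walk⇔ : ∀ (G : Graph) {j} J (xs : Fin (suc (suc j)) → Var (suc j)) (φs : Fin (suc j) → Form (suc j))
             (a : Var (suc j) → Fin (n G)) {E : Pred (Vec (Fin (n G)) (suc (suc j))) 0ℓ} (E? : Decidable E) →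
             (∀ w → (∀ i → Sat G (φs i) (updAll xs (lookup w) a)) ⇔ E w) →
             Sat G (∃walk J xs φs) a ⇔ (J ≤ count E? (walks j (a (xs zero)) (a (xs (fromℕ (suc j))))))
Sat-∃walk⇔ G {j} J xs φs a E? φs⇔E = mk⇔ ⇒ ⇐
  where
  W = walks j (a (xs zero)) (a (xs (fromℕ (suc j))))
  ⇒ : Sat G (∃walk J xs φs) a → J ≤ count E? W
  ⇒ (ws , J≤ , ws-unique , ws-ok) = begin
    J                     ≤⟨ J≤ ⟩
    length ws             ≤⟨ Unique-⊆⇒length≤ ws-unique ws⊆ ⟩
    length (filter E? W)  ≡⟨ length-filter E? W ⟩
    count E? W            ∎
    where
    open ≤-Reasoning
    ws⊆ : ws ⊆ filter E? W
    ws⊆ w∈ with w0 , wlast , φs-hold ← All.lookup ws-ok w∈ =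
      ∈-filter⁺ E? (∈-walks⁺ _ w0 wlast) (to (φs⇔E _) φs-hold)
  ⇐ : J ≤ count E? W → Sat G (∃walk J xs φs) a
  ⇐ J≤ = filter E? W , subst (J ≤_) (sym (length-filter E? W)) J≤ , UniqueP.filter⁺ E? (walks-unique j _ _) ,
         All.tabulate (λ w∈ → let w∈W , e = ∈-filter⁻ E? w∈ ; w0 , wlast = ∈-walks⁻ w∈W
                              in w0 , wlast , from (φs⇔E _) e)

Sat-∃walk⇔walkCount : ∀ (G : Graph) {j} J (xs : Fin (suc (suc j)) → Var (suc j)) (φs : Fin (suc j) → Form (suc j))
                      (a : Var (suc j) → Fin (n G)) {R : Fin (suc j) → Fin (n G) → Fin (n G) → Set}
                      (R? : ∀ i → B.Decidable (R i)) →
                      (∀ w i → Sat G (φs i) (updAll xs (lookup w) a) ⇔ R i (lookup w (inject₁ i)) (lookup w (suc i))) →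
                      Sat G (∃walk J xs φs) a ⇔ (J ≤ walkCount j R R? (a (xs zero)) (a (xs (fromℕ (suc j)))))
Sat-∃walk⇔walkCount G {j} J xs φs a {R} R? φs⇔R =
  ⇔-resp-≡₂ _≤_ refl (count-walks j R R? (Edgewise? R?) _ _)
            (Sat-∃walk⇔ G J xs φs a (Edgewise? R?) (∀-cong-⇔ ∘ φs⇔R))

module _ {N : ℕ} where

  transpose-≡ˡ : (i j : Fin N) → transpose i j i ≡ j
  transpose-≡ˡ i j rewrite Dec.dec-true (i Fin.≟ i) refl = refl

  transpose-≢ : (i j k : Fin N) → k ≢ i → k ≢ j → transpose i j k ≡ k
  transpose-≢ i j k k≢i k≢j rewrite Dec.dec-false (k Fin.≟ i) k≢i | Dec.dec-false (k Fin.≟ j) k≢j = refl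

  transpose-injective : (i j : Fin N) → Injective _≡_ _≡_ (transpose i j)
  transpose-injective i j {k} {l} eq = begin
    k                               ≡⟨ transpose-inverse j i ⟨
    transpose j i (transpose i j k) ≡⟨ cong (transpose j i) eq ⟩
    transpose j i (transpose i j l) ≡⟨ transpose-inverse j i ⟩
    l                               ∎
    where open ≡-Reasoning

walkVars : ∀ {k} → Var (suc k) → Var (suc k) → Fin (suc (suc k)) → Var (suc k)
walkVars {k} x y = transpose zero x ∘ transpose (fromℕ (suc k)) (transpose x zero y)

walkVars-injective : ∀ {k} (x y : Var (suc k)) → Injective _≡_ _≡_ (walkVars x y)
walkVars-injective {k} x y = transpose-injective (fromℕ (suc k)) _ ∘ transpose-injective zero x

walkVars-last : ∀ {k} (x y : Var (suc k)) → walkVars x y (fromℕ (suc k)) ≡ y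
walkVars-last {k} x y = trans (cong (transpose zero x) (transpose-≡ˡ (fromℕ (suc k)) _)) (transpose-inverse zero x)

walkVars-zero : ∀ {k} (x y : Var (suc k)) → x ≢ y → walkVars x y zero ≡ x
walkVars-zero {k} x y x≢y = begin
  transpose zero x (transpose (fromℕ (suc k)) (transpose x zero y) zero)
    ≡⟨ cong (transpose zero x) (transpose-≢ (fromℕ (suc k)) _ zero (λ ()) 0≢y′) ⟩
  transpose zero x zero
    ≡⟨ transpose-≡ˡ zero x ⟩
  x
    ∎
  where
  open ≡-Reasoning
  0≢y′ : zero ≢ transpose x zero y
  0≢y′ 0≡y′ = x≢y (begin
    x                                     ≡⟨ transpose-≡ˡ zero x ⟨
    transpose zero x zero                 ≡⟨ cong (transpose zero x) 0≡y′ ⟩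
    transpose zero x (transpose x zero y) ≡⟨ transpose-inverse zero x ⟩
    y                                     ∎)

FreeAmong : ∀ {k} → Form k → Var k → Var k → Set
FreeAmong φ x y = ∀ z → Free φ z → z ≡ x ⊎ z ≡ y

maxF-lub : ∀ {k} (f : Fin k → ℕ) {d} → (∀ i → f i ≤ d) → maxF f ≤ d
maxF-lub {zero}  f f≤d = z≤n
maxF-lub {suc k} f f≤d = ⊔-lub (f≤d zero) (maxF-lub (f ∘ suc) (f≤d ∘ suc))

∃walk-qd : ∀ {k} J (xs : Fin (suc k) → Var k) (φs : Fin k → Form k) {d} →
           (∀ i → qd (φs i) ≤ d) → qd (∃walk J xs φs) ≤ suc d
∃walk-qd J xs φs qd≤d = s≤s (maxF-lub (qd ∘ φs) qd≤d)

¬Interior⇒endpoint : ∀ {j} (p : Fin (suc (suc j))) → ¬ Interior p → p ≡ zero ⊎ p ≡ fromℕ (suc j)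
¬Interior⇒endpoint {j} p ¬interior with toℕ p ℕ.≟ 0 | toℕ p ℕ.≟ suc j
... | yes p≡0 | _        = inj₁ (Fin.toℕ-injective p≡0)
... | no _    | yes p≡k  = inj₂ (Fin.toℕ-injective (trans p≡k (sym (Fin.toℕ-fromℕ (suc j)))))
... | no p≢0  | no p≢k   = ⊥-elim (¬interior (p≢0 , p≢k))

∃walk-FreeAmong : ∀ {j} J (xs : Fin (suc (suc j)) → Var (suc j)) (φs : Fin (suc j) → Form (suc j)) →
                  (∀ i → FreeAmong (φs i) (xs (inject₁ i)) (xs (suc i))) →
                  FreeAmong (∃walk J xs φs) (xs zero) (xs (fromℕ (suc j)))
∃walk-FreeAmong {j} J xs φs free z ((i , z∈φi) , not-interior) = [ endpoint , endpoint ]′ (free i z z∈φi)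
  where
  endpoint : ∀ {p} → z ≡ xs p → z ≡ xs zero ⊎ z ≡ xs (fromℕ (suc j))
  endpoint {p} refl with ¬Interior⇒endpoint p (λ interior → not-interior (p , interior , refl))
  ... | inj₁ refl = inj₁ refl
  ... | inj₂ refl = inj₂ refl

data PairType : Set where
  equal edge nonEdge : PairType

pairType : (G : Graph) → Fin (n G) → Fin (n G) → PairType
pairType G u v with u Fin.≟ v | adj G u v
... | yes _ | _     = equal
... | no _  | true  = edge
... | no _  | false = nonEdge

pairTypeColour : PairType → ℤ.ℤ
pairTypeColour equal   = ℤ.-[1+ 0 ]
pairTypeColour edge    = ℤ.+ 1
pairTypeColour nonEdge = ℤ.+ 0

χ₀≡pairTypeColour : ∀ G u v → χ₀ G u v ≡ pairTypeColour (pairType G u v)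
χ₀≡pairTypeColour G u v with u Fin.≟ v
... | yes _ = refl
... | no _ with adj G u v
...   | true  = refl
...   | false = refl

pairTypeColour-injective : ∀ {t t′} → pairTypeColour t ≡ pairTypeColour t′ → t ≡ t′
pairTypeColour-injective {equal}   {equal}   _ = refl
pairTypeColour-injective {edge}    {edge}    _ = refl
pairTypeColour-injective {nonEdge} {nonEdge} _ = refl
pairTypeColour-injective {equal}   {edge}    ()
pairTypeColour-injective {equal}   {nonEdge} ()
pairTypeColour-injective {edge}    {equal}   ()
pairTypeColour-injective {edge}    {nonEdge} ()
pairTypeColour-injective {nonEdge} {equal}   ()
pairTypeColour-injective {nonEdge} {edge}    ()

χ₀≡⇔pairType≡ : ∀ G G′ u v u′ v′ → (χ₀ G u v ≡ χ₀ G′ u′ v′) ⇔ (pairType G u v ≡ pairType G′ u′ v′)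
χ₀≡⇔pairType≡ G G′ u v u′ v′ = mk⇔
  (λ χ₀≡ → pairTypeColour-injective (trans (sym (χ₀≡pairTypeColour G u v)) (trans χ₀≡ (χ₀≡pairTypeColour G′ u′ v′))))
  (λ t≡ → trans (χ₀≡pairTypeColour G u v) (trans (cong pairTypeColour t≡) (sym (χ₀≡pairTypeColour G′ u′ v′))))

typeFormula : ∀ {k} → PairType → Var k → Var k → Form k
typeFormula equal   x y = x ≐ y
typeFormula edge    x y = (x ∼ y) ∧ (¬ᶠ (x ≐ y))
typeFormula nonEdge x y = (¬ᶠ (x ≐ y)) ∧ (¬ᶠ (x ∼ y))

false≢true : false ≢ true
false≢true ()

Sat-typeFormula⇔ : ∀ {k} G t (a : Var k → Fin (n G)) x y →
                   Sat G (typeFormula t x y) a ⇔ (pairType G (a x) (a y) ≡ t)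
Sat-typeFormula⇔ G t a x y with a x Fin.≟ a y | adj G (a x) (a y) in adj≡
Sat-typeFormula⇔ G equal   a x y | yes ax≡ay | _     = mk⇔ (λ _ → refl) (λ _ → ax≡ay)
Sat-typeFormula⇔ G edge    a x y | yes ax≡ay | _     = mk⇔ (λ (_ , ax≢ay) → ⊥-elim (ax≢ay ax≡ay)) (λ ())
Sat-typeFormula⇔ G nonEdge a x y | yes ax≡ay | _     = mk⇔ (λ (ax≢ay , _) → ⊥-elim (ax≢ay ax≡ay)) (λ ())
Sat-typeFormula⇔ G equal   a x y | no ax≢ay  | true  = mk⇔ (⊥-elim ∘ ax≢ay) (λ ())
Sat-typeFormula⇔ G equal   a x y | no ax≢ay  | false = mk⇔ (⊥-elim ∘ ax≢ay) (λ ())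
Sat-typeFormula⇔ G edge    a x y | no ax≢ay  | true  = mk⇔ (λ _ → refl) (λ _ → adj≡ , ax≢ay)
Sat-typeFormula⇔ G nonEdge a x y | no ax≢ay  | true  = mk⇔ (λ (_ , ¬adj) → ⊥-elim (¬adj adj≡)) (λ ())
Sat-typeFormula⇔ G edge    a x y | no ax≢ay  | false = mk⇔ (⊥-elim ∘ false≢true ∘ trans (sym adj≡) ∘ proj₁) (λ ())
Sat-typeFormula⇔ G nonEdge a x y | no ax≢ay  | false = mk⇔ (λ _ → refl) (λ _ → ax≢ay , false≢true ∘ trans (sym adj≡))


typeFormula-FreeAmong : ∀ {k} t (x y : Var k) → FreeAmong (typeFormula t x y) x y
typeFormula-FreeAmong equal   x y z z∈ = z∈
typeFormula-FreeAmong edge    x y z z∈ = reduce z∈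
typeFormula-FreeAmong nonEdge x y z z∈ = reduce z∈

typeFormula-WF : ∀ {k} t (x y : Var k) → WF (typeFormula t x y)
typeFormula-WF equal   x y = tt
typeFormula-WF edge    x y = tt , tt
typeFormula-WF nonEdge x y = tt , tt

typeFormula-qd : ∀ {k} t (x y : Var k) {d} → qd (typeFormula t x y) ≤ d
typeFormula-qd equal   x y = z≤n
typeFormula-qd edge    x y = z≤n
typeFormula-qd nonEdge x y = z≤n

⋀ : ∀ {k} → Var k → List (Form k) → Form k
⋀ x []       = x ≐ x
⋀ x (φ ∷ φs) = φ ∧ ⋀ x φs

Sat-⋀⇔ : ∀ {k} G (a : Var k → Fin (n G)) x φs → Sat G (⋀ x φs) a ⇔ All (λ φ → Sat G φ a) φs
Sat-⋀⇔ G a x []       = mk⇔ (λ _ → []) (λ _ → refl)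
Sat-⋀⇔ G a x (φ ∷ φs) =
  mk⇔ (λ (s , ss) → s ∷ to (Sat-⋀⇔ G a x φs) ss) (λ { (s ∷ ss) → s , from (Sat-⋀⇔ G a x φs) ss })

⋀-FreeAmong : ∀ {k} (x y : Var k) {φs} → All (λ φ → FreeAmong φ x y) φs → FreeAmong (⋀ x φs) x y
⋀-FreeAmong x y []         z z∈         = inj₁ (reduce z∈)
⋀-FreeAmong x y (free ∷ _) z (inj₁ z∈φ) = free z z∈φ
⋀-FreeAmong x y (_ ∷ free) z (inj₂ z∈φs) = ⋀-FreeAmong x y free z z∈φs

⋀-WF : ∀ {k} (x : Var k) {φs} → All WF φs → WF (⋀ x φs)
⋀-WF x []        = tt
⋀-WF x (wf ∷ wfs) = wf , ⋀-WF x wfs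

⋀-qd : ∀ {k} (x : Var k) {φs d} → All (λ φ → qd φ ≤ d) φs → qd (⋀ x φs) ≤ d
⋀-qd x []           = z≤n
⋀-qd x (qd≤ ∷ qds≤) = ⊔-lub qd≤ (⋀-qd x qds≤)

exactly : ∀ {k} → ℕ → (Fin (suc k) → Var k) → (Fin k → Form k) → Form k
exactly N xs φs = ∃walk N xs φs ∧ (¬ᶠ ∃walk (suc N) xs φs)

≤×≱⇔≡ : ∀ {N c} → (N ≤ c × ¬ suc N ≤ c) ⇔ (c ≡ N)
≤×≱⇔≡ {N} {c} = mk⇔ (λ (N≤c , c≯N) → ≤-antisym (≮⇒≥ c≯N) N≤c) (λ { refl → ≤-refl , n≮n c })

Sat-exactly⇔ : ∀ (G : Graph) {j} N (xs : Fin (suc (suc j)) → Var (suc j)) (φs : Fin (suc j) → Form (suc j))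
               (a : Var (suc j) → Fin (n G)) {E : Pred (Vec (Fin (n G)) (suc (suc j))) 0ℓ} (E? : Decidable E) →
               (∀ w → (∀ i → Sat G (φs i) (updAll xs (lookup w) a)) ⇔ E w) →
               Sat G (exactly N xs φs) a ⇔ (count E? (walks j (a (xs zero)) (a (xs (fromℕ (suc j))))) ≡ N)
Sat-exactly⇔ G N xs φs a E? φs⇔E = mk⇔
  (λ (atLeast , notMore) → to ≤×≱⇔≡ (to (Sat-N) atLeast , notMore ∘ from Sat-suc-N))
  (λ c≡N → let N≤c , c≱ = from ≤×≱⇔≡ c≡N in from Sat-N N≤c , c≱ ∘ to Sat-suc-N)
  where
  Sat-N     = Sat-∃walk⇔ G N xs φs a E? φs⇔E
  Sat-suc-N = Sat-∃walk⇔ G (suc N) xs φs a E? φs⇔E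

inject₁≢suc : ∀ {k} (i : Fin k) → inject₁ i ≢ suc i
inject₁≢suc zero    ()
inject₁≢suc (suc i) eq = inject₁≢suc i (Fin.suc-injective eq)

module _ {j} (xs : Fin (suc (suc j)) → Var (suc j)) (φs : Fin (suc j) → Form (suc j))
         (free : ∀ i → FreeAmong (φs i) (xs (inject₁ i)) (xs (suc i))) where

  exactly-FreeAmong : ∀ N → FreeAmong (exactly N xs φs) (xs zero) (xs (fromℕ (suc j)))
  exactly-FreeAmong N z (inj₁ z∈) = ∃walk-FreeAmong N xs φs free z z∈
  exactly-FreeAmong N z (inj₂ z∈) = ∃walk-FreeAmong (suc N) xs φs free z z∈

  exactly-WF : Injective _≡_ _≡_ xs → (∀ i → WF (φs i)) → ∀ N → WF (exactly N xs φs)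
  exactly-WF xs-inj wf N = (xs-inj , free , wf) , (xs-inj , free , wf)

exactly-qd : ∀ {k} N (xs : Fin (suc k) → Var k) (φs : Fin k → Form k) {d} →
             (∀ i → qd (φs i) ≤ d) → qd (exactly N xs φs) ≤ suc d
exactly-qd N xs φs qd≤d = ⊔-lub (∃walk-qd N xs φs qd≤d) (∃walk-qd (suc N) xs φs qd≤d)

-- Formulas for the colour classes

module ColourClasses (G₁ G₂ : Graph) (j : ℕ) where

  k : ℕ
  k = suc j

  data Side : Set where
    ₁ ₂ : Side

  graph : Side → Graph
  graph ₁ = G₁
  graph ₂ = G₂

  V : Side → Set
  V s = Fin (n (graph s))

  colour : ∀ m s → V s → V s → Col m
  colour m s = iterW k (graph s) m

  Pair : Set
  Pair = Σ Side λ s → V s × V s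

  colourOf : ∀ m → Pair → Col m
  colourOf m (s , u , v) = colour m s u v

  Walk : Set
  Walk = Σ Side λ s → Vec (V s) (suc k)

  allWalks : List Walk
  allWalks = map (₁ ,_) (allVecs (suc k)) ++ map (₂ ,_) (allVecs (suc k))

  ∈-allWalks : ∀ s w → (s , w) ∈ allWalks
  ∈-allWalks ₁ w = ∈-++⁺ˡ (∈-map⁺ (₁ ,_) (∈-allVecs w))
  ∈-allWalks ₂ w = ∈-++⁺ʳ _ (∈-map⁺ (₂ ,_) (∈-allVecs w))

  step : Walk → Fin k → Pair
  step (s , w) i = s , lookup w (inject₁ i) , lookup w (suc i)

  stepColours : ∀ m → Walk → List (Col m)
  stepColours m (s , w) = walkCols (colour m s) (toList w)

  #walksLike : ∀ m s → V s → V s → Walk → ℕ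
  #walksLike m s p q bw =
    count (λ w → LPW.decidable (ColEq? m) (stepColours m (s , w)) (stepColours m bw)) (walks j p q)

  classFormula : ℕ → Pair → Var k → Var k → Form k
  multiplicityFormula : ℕ → Pair → Var k → Var k → Walk → Form k
  stepFormulas : ℕ → Walk → Var k → Var k → Fin k → Form k
  classFormula zero    (s , u , v) x y = typeFormula (pairType (graph s) u v) x y
  classFormula (suc m) r           x y = ⋀ x (map (multiplicityFormula m r x y) allWalks)
  multiplicityFormula m (s , u , v) x y bw = exactly (#walksLike m s u v bw) (walkVars x y) (stepFormulas m bw x y)
  stepFormulas m bw x y i = classFormula m (step bw i) (walkVars x y (inject₁ i)) (walkVars x y (suc i))

  walkVars-step≢ : ∀ (x y : Var k) i → walkVars x y (inject₁ i) ≢ walkVars x y (suc i)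
  walkVars-step≢ x y i = inject₁≢suc i ∘ walkVars-injective x y

  classFormula-FreeAmong : ∀ m r (x y : Var k) → x ≢ y → FreeAmong (classFormula m r x y) x y
  classFormula-FreeAmong zero    (s , u , v) x y _   = typeFormula-FreeAmong (pairType (graph s) u v) x y
  classFormula-FreeAmong (suc m) r@(s , u , v) x y x≢y =
    ⋀-FreeAmong x y (AllP.map⁺ (All.universal conjunct-FreeAmong allWalks))
    where
    conjunct-FreeAmong : ∀ bw → FreeAmong (multiplicityFormula m r x y bw) x y
    conjunct-FreeAmong bw =
      subst₂ (FreeAmong (multiplicityFormula m r x y bw)) (walkVars-zero x y x≢y) (walkVars-last x y)
      (exactly-FreeAmong (walkVars x y) (stepFormulas m bw x y)
        (λ i → classFormula-FreeAmong m (step bw i) _ _ (walkVars-step≢ x y i)) (#walksLike m s u v bw))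

  classFormula-WF : ∀ m r (x y : Var k) → x ≢ y → WF (classFormula m r x y)
  classFormula-WF zero    (s , u , v) x y _   = typeFormula-WF (pairType (graph s) u v) x y
  classFormula-WF (suc m) r@(s , u , v) x y x≢y = ⋀-WF x (AllP.map⁺ (All.universal conjunct-WF allWalks))
    where
    conjunct-WF : ∀ bw → WF (multiplicityFormula m r x y bw)
    conjunct-WF bw = exactly-WF (walkVars x y) (stepFormulas m bw x y)
      (λ i → classFormula-FreeAmong m (step bw i) _ _ (walkVars-step≢ x y i)) (walkVars-injective x y)
      (λ i → classFormula-WF m (step bw i) _ _ (walkVars-step≢ x y i)) (#walksLike m s u v bw)

  classFormula-qd : ∀ m r (x y : Var k) → qd (classFormula m r x y) ≤ m
  classFormula-qd zero    (s , u , v) x y = typeFormula-qd (pairType (graph s) u v) x y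
  classFormula-qd (suc m) r@(s , u , v) x y = ⋀-qd x (AllP.map⁺ (All.universal conjunct-qd allWalks))
    where
    conjunct-qd : ∀ bw → qd (multiplicityFormula m r x y bw) ≤ suc m
    conjunct-qd bw = exactly-qd (#walksLike m s u v bw) (walkVars x y) (stepFormulas m bw x y)
      (λ i → classFormula-qd m (step bw i) _ _)

  module Sequences m = Multiplicity (LPW.setoid (ColS m)) (LPW.decidable (ColEq? m))

  multiplicity-colour : ∀ m s p q bw →
                        Sequences.multiplicity m (stepColours m bw) (colour (suc m) s p q) ≡ #walksLike m s p q bw
  multiplicity-colour m s p q bw =
    trans (cong (Sequences.multiplicity m (stepColours m bw)) (walkRefine≡map-walks j (colour m s) p q))
          (count-map _ (walkCols (colour m s) ∘ toList) (walks j p q))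

  ∈-colour⇒stepColours : ∀ m s p q {t} → t ∈ colour (suc m) s p q → ∃ λ w → t ≡ stepColours m (s , w)
  ∈-colour⇒stepColours m s p q t∈
    with w , _ , t≡ ← ∈-map⁻ (walkCols (colour m s) ∘ toList)
                             (subst (_ ∈_) (walkRefine≡map-walks j (colour m s) p q) t∈)
    = w , t≡

  colour-suc≈⇔ : ∀ m s p q s′ p′ q′ →
                 (colour (suc m) s p q ≈[ suc m ] colour (suc m) s′ p′ q′) ⇔
                 All (λ bw → #walksLike m s p q bw ≡ #walksLike m s′ p′ q′ bw) allWalks
  colour-suc≈⇔ m s p q s′ p′ q′ = mk⇔
    (λ C↭C′ → All.universal (λ bw → to (same⇔similar bw) (Sequences.multiplicity-resp-↭ m (stepColours m bw) C↭C′))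
                            allWalks)
    (λ similar → from (Sequences.↭⇔SameMultiplicities m C C′) (All.tabulate (λ t∈ → same similar (∈-++⁻ C t∈))))
    where
    C  = colour (suc m) s p q
    C′ = colour (suc m) s′ p′ q′
    same⇔similar : ∀ bw → (Sequences.multiplicity m (stepColours m bw) C ≡ Sequences.multiplicity m (stepColours m bw) C′) ⇔
                          (#walksLike m s p q bw ≡ #walksLike m s′ p′ q′ bw)
    same⇔similar bw = mk⇔
      (λ eq → trans (sym (multiplicity-colour m s p q bw)) (trans eq (multiplicity-colour m s′ p′ q′ bw)))
      (λ eq → trans (multiplicity-colour m s p q bw) (trans eq (sym (multiplicity-colour m s′ p′ q′ bw))))
    same : ∀ {t} → All (λ bw → #walksLike m s p q bw ≡ #walksLike m s′ p′ q′ bw) allWalks → t ∈ C ⊎ t ∈ C′ →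
           Sequences.multiplicity m t C ≡ Sequences.multiplicity m t C′
    same similar (inj₁ t∈) with w , refl ← ∈-colour⇒stepColours m s p q t∈ =
      from (same⇔similar (s , w)) (All.lookup similar (∈-allWalks s w))
    same similar (inj₂ t∈) with w , refl ← ∈-colour⇒stepColours m s′ p′ q′ t∈ =
      from (same⇔similar (s′ , w)) (All.lookup similar (∈-allWalks s′ w))

  Sat-classFormula⇔ : ∀ m r s (a : Var k → V s) x y → x ≢ y →
                      Sat (graph s) (classFormula m r x y) a ⇔ (colour m s (a x) (a y) ≈[ m ] colourOf m r)
  Sat-multiplicityFormula⇔ : ∀ m s′ (u v : V s′) s (a : Var k → V s) x y → x ≢ y → ∀ bw →
                             Sat (graph s) (multiplicityFormula m (s′ , u , v) x y bw) a ⇔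
                             (#walksLike m s (a x) (a y) bw ≡ #walksLike m s′ u v bw)
  Sat-stepFormulas⇔ : ∀ m bw s (a : Var k → V s) x y (w : Vec (V s) (suc k)) →
                      (∀ i → Sat (graph s) (stepFormulas m bw x y i) (updAll (walkVars x y) (lookup w) a)) ⇔
                      Pointwise (ColEq m) (stepColours m (s , w)) (stepColours m bw)

  Sat-classFormula⇔ zero (s′ , u , v) s a x y _ =
    ⇔-trans (Sat-typeFormula⇔ (graph s) (pairType (graph s′) u v) a x y)
            (⇔-sym (χ₀≡⇔pairType≡ (graph s) (graph s′) (a x) (a y) u v))
  Sat-classFormula⇔ (suc m) r@(s′ , u , v) s a x y x≢y =
    ⇔-trans (Sat-⋀⇔ (graph s) a x (map (multiplicityFormula m r x y) allWalks))
    (⇔-trans (All-map-⇔ (multiplicityFormula m r x y))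
    (⇔-trans (All-cong-⇔ (Sat-multiplicityFormula⇔ m s′ u v s a x y x≢y))
             (⇔-sym (colour-suc≈⇔ m s (a x) (a y) s′ u v))))

  Sat-multiplicityFormula⇔ m s′ u v s a x y x≢y bw =
    ⇔-resp-≡₂ (λ p q → #walksLike m s p q bw ≡ #walksLike m s′ u v bw)
              (cong a (walkVars-zero x y x≢y)) (cong a (walkVars-last x y))
              (Sat-exactly⇔ (graph s) _ (walkVars x y) (stepFormulas m bw x y) a _ (Sat-stepFormulas⇔ m bw s a x y))

  Sat-stepFormulas⇔ m bw@(s′ , w′) s a x y w =
    ⇔-trans (∀-cong-⇔ Sat-step⇔) (⇔-sym (Pointwise-walkCols⇔ (ColEq m) (colour m s) (colour m s′) w w′))
    where
    a′ = updAll (walkVars x y) (lookup w) a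
    at : ∀ p → a′ (walkVars x y p) ≡ lookup w p
    at = updAll-injective (walkVars x y) (lookup w) a (walkVars-injective x y)
    Sat-step⇔ : ∀ i → Sat (graph s) (stepFormulas m bw x y i) a′ ⇔
                      (colour m s (lookup w (inject₁ i)) (lookup w (suc i)) ≈[ m ] colourOf m (step bw i))
    Sat-step⇔ i = ⇔-resp-≡₂ (λ p q → colour m s p q ≈[ m ] colourOf m (step bw i)) (at (inject₁ i)) (at (suc i))
                         (Sat-classFormula⇔ m (step bw i) s a′ _ _ (walkVars-step≢ x y i))

  #pairs : ∀ m s → Col m → ℕ
  #pairs m s c = ∑[ u < n (graph s) ] ∑[ v < n (graph s) ] 𝟙 (colour m s u v ≟[ m ] c)

  module Colours m = Multiplicity (ColS m) (ColEq? m)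

  multiplicity-pairColours : ∀ m s c → Colours.multiplicity m c (pairColours k (graph s) m) ≡ #pairs m s c
  multiplicity-pairColours m s c =
    trans (count-concatMap ≟c (λ u → map (colour m s u) (allFin (n (graph s)))) id)
          (sum-cong-≗ λ u → trans (count-map ≟c (colour m s u) (allFin _)) (count-tabulate (≟c ∘ colour m s u) id))
    where
    ≟c : Decidable (λ c′ → c′ ≈[ m ] c)
    ≟c c′ = c′ ≟[ m ] c

  ∈-pairColours : ∀ m s {c} → c ∈ pairColours k (graph s) m → ∃ λ u → ∃ λ v → c ≡ colour m s u v
  ∈-pairColours m s c∈
    with row , c∈row , row∈ ← ∈-concat⁻′ (map (λ u → map (colour m s u) (allFin _)) (allFin _)) c∈
    with u , _ , refl ← ∈-map⁻ (λ u → map (colour m s u) (allFin _)) row∈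
    with v , _ , c≡ ← ∈-map⁻ (colour m s u) c∈row
    = u , v , c≡

  ∈-pairColours⇒colourOf : ∀ m {c} → c ∈ pairColours k G₁ m ++ pairColours k G₂ m → ∃ λ r → c ≡ colourOf m r
  ∈-pairColours⇒colourOf m c∈ with ∈-++⁻ (pairColours k G₁ m) c∈
  ... | inj₁ c∈₁ = let u , v , c≡ = ∈-pairColours m ₁ c∈₁ in (₁ , u , v) , c≡
  ... | inj₂ c∈₂ = let u , v , c≡ = ∈-pairColours m ₂ c∈₂ in (₂ , u , v) , c≡

  WalkDistinguishes⇒#pairs≢ : ∀ m → WalkDistinguishes k m G₁ G₂ →
                              ∃ λ r → #pairs m ₁ (colourOf m r) ≢ #pairs m ₂ (colourOf m r)
  WalkDistinguishes⇒#pairs≢ m dist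
    with c , c∈ , c≢ ← Colours.¬↭⇒multiplicity≢ m (pairColours k G₁ m) (pairColours k G₂ m) dist
    with r , refl ← ∈-pairColours⇒colourOf m c∈
    = r , λ eq → c≢ (trans (multiplicity-pairColours m ₁ _) (trans eq (sym (multiplicity-pairColours m ₂ _))))

DistinguishingSentence : (k d : ℕ) → Graph → Graph → Set
DistinguishingSentence k d G H = Σ (Form k) (λ φ → Sentence φ × qd φ ≡ d × Distinguishes φ G H)

inhabited? : ∀ N → Fin N ⊎ ¬ Fin N
inhabited? zero    = inj₂ (λ ())
inhabited? (suc N) = inj₁ zero

module _ {k : ℕ} where

  Distinguishes-sym : ∀ {φ : Form k} {G H} → Distinguishes φ G H → Distinguishes φ H G
  Distinguishes-sym dist (G⇒H , H⇒G) = dist (H⇒G , G⇒H)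

  holds-fails⇒Distinguishes : ∀ (φ : Form k) {G H} → (∀ a → Sat G φ a) → (∀ a → ¬ Sat H φ a) → Fin (n G) →
                              Distinguishes φ G H ⊎ Distinguishes (¬ᶠ φ) G H
  holds-fails⇒Distinguishes φ {G} {H} holds fails u with inhabited? (n H)
  ... | inj₁ v     = inj₁ (λ (G⇒H , _) → fails (λ _ → v) (G⇒H holds (λ _ → v)))
  ... | inj₂ empty = inj₂ (λ (_ , H⇒G) → H⇒G (λ a → ⊥-elim (empty (a zero))) (λ _ → u) (holds (λ _ → u)))

Interior-inject₁-suc : ∀ {k} (i : Fin k) → Interior {suc k} (inject₁ (suc i))
Interior-inject₁-suc i = (λ ()) , (λ eq → Fin.toℕ-inject₁-≢ i (sym (suc-injective eq)))

Interior-suc : ∀ {k} (i : Fin (suc k)) → toℕ i ≢ k → Interior {suc k} (suc i)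
Interior-suc i i≢k = (λ ()) , (i≢k ∘ suc-injective)

∃walk-Sentence : ∀ {k} J (φs : Fin k → Form k) → (∀ i → FreeAmong (φs i) (inject₁ i) (suc i)) →
                 (∀ i z → Free (φs i) z → Interior z) → (∀ i → WF (φs i)) → Sentence (∃walk J id φs)
∃walk-Sentence J φs free interior wf =
  (id , free , wf) , λ z ((i , z∈) , not-interior) → not-interior (z , interior i z z∈ , refl)

module _ {j : ℕ} where

  private
    interiorTruth : Fin (suc (suc j)) → Form (suc (suc j))
    interiorTruth zero    = suc zero ≐ suc zero
    interiorTruth (suc i) = inject₁ (suc i) ≐ inject₁ (suc i)

  -- ∃⁰ holds vacuously, so nesting it gives true sentences of every positive depth
  trueSentence : ℕ → Form (suc (suc j))
  trueSentence zero    = ∃walk 0 id interiorTruth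
  trueSentence (suc d) = ∃walk 0 id (λ _ → trueSentence d)

  trueSentence-holds : ∀ G d (a : Var (suc (suc j)) → Fin (n G)) → Sat G (trueSentence d) a
  trueSentence-holds G zero    a = [] , z≤n , [] , []
  trueSentence-holds G (suc d) a = [] , z≤n , [] , []

  trueSentence-Sentence : ∀ d → Sentence (trueSentence d)
  trueSentence-Sentence zero = ∃walk-Sentence 0 interiorTruth free interior (λ { zero → tt ; (suc i) → tt })
    where
    free : ∀ i → FreeAmong (interiorTruth i) (inject₁ i) (suc i)
    free zero    z z∈ = inj₂ (reduce z∈)
    free (suc i) z z∈ = inj₁ (reduce z∈)
    interior : ∀ i z → Free (interiorTruth i) z → Interior z
    interior zero    z z∈ with refl ← reduce z∈ = Interior-suc zero (λ ())
    interior (suc i) z z∈ with refl ← reduce z∈ = Interior-inject₁-suc i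
  trueSentence-Sentence (suc d) = ∃walk-Sentence 0 (λ _ → trueSentence d)
    (λ _ z z∈ → ⊥-elim (proj₂ (trueSentence-Sentence d) z z∈))
    (λ _ z z∈ → ⊥-elim (proj₂ (trueSentence-Sentence d) z z∈))
    (λ _ → proj₁ (trueSentence-Sentence d))

  trueSentence-qd : ∀ d → qd (trueSentence d) ≡ suc d
  trueSentence-qd zero    = cong suc (n≤0⇒n≡0 (maxF-lub (qd ∘ interiorTruth) (λ { zero → z≤n ; (suc i) → z≤n })))
  trueSentence-qd (suc d) = cong suc (trans (maxF-const {suc j} (qd (trueSentence d))) (trueSentence-qd d))
    where
    maxF-const : ∀ {t} c → maxF {suc t} (λ _ → c) ≡ c
    maxF-const {zero}  c = ⊔-identityʳ c
    maxF-const {suc t} c = trans (cong (c ⊔_) (maxF-const {t} c)) (⊔-idem c)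

Counts : ∀ {k} (G : Graph) → (ℕ → Form k) → ℕ → Set
Counts G S c = ∀ J a → Sat G (S J) a ⇔ (J ≤ c)

module _ {j} (S : ℕ → Form (suc (suc j))) (d : ℕ)
         (S-Sentence : ∀ J → Sentence (S J)) (S-qd : ∀ J → qd (S J) ≤ suc d) where

  private
    padded-Sentence : ∀ J → Sentence (S J ∧ trueSentence d)
    padded-Sentence J = (proj₁ (S-Sentence J) , proj₁ (trueSentence-Sentence d)) ,
                        λ z → [ proj₂ (S-Sentence J) z , proj₂ (trueSentence-Sentence d) z ]′

    padded-qd : ∀ J → qd (S J ∧ trueSentence d) ≡ suc d
    padded-qd J = trans (cong (qd (S J) ⊔_) (trueSentence-qd d)) (m≤n⇒m⊔n≡n (S-qd J))

  count>⇒DistinguishingSentence : ∀ {G H} cG cH → Counts G S cG → Counts H S cH → (0 < cG → Fin (n G)) → cH < cG →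
                                  DistinguishingSentence (suc (suc j)) (suc d) G H
  count>⇒DistinguishingSentence {G} {H} cG cH G⇔ H⇔ inhabited cH<cG
    with holds-fails⇒Distinguishes (S cG ∧ trueSentence d) holds fails (inhabited (≤-<-trans z≤n cH<cG))
    where
    holds : ∀ a → Sat G (S cG ∧ trueSentence d) a
    holds a = from (G⇔ cG a) ≤-refl , trueSentence-holds G d a
    fails : ∀ a → ¬ Sat H (S cG ∧ trueSentence d) a
    fails a (S-holds , _) = <⇒≱ cH<cG (to (H⇔ cG a) S-holds)
  ... | inj₁ dist = S cG ∧ trueSentence d , padded-Sentence cG , padded-qd cG , dist
  ... | inj₂ dist = ¬ᶠ (S cG ∧ trueSentence d) , padded-Sentence cG , padded-qd cG , dist

  count≢⇒DistinguishingSentence : ∀ {G H} cG cH → Counts G S cG → Counts H S cH →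
                                  (0 < cG → Fin (n G)) → (0 < cH → Fin (n H)) → cG ≢ cH →
                                  DistinguishingSentence (suc (suc j)) (suc d) G H
  count≢⇒DistinguishingSentence cG cH G⇔ H⇔ inhabitedG inhabitedH cG≢cH with <-cmp cG cH
  ... | tri< cG<cH _ _ =
    let φ , sentence , depth , dist = count>⇒DistinguishingSentence cH cG H⇔ G⇔ inhabitedH cG<cH
    in φ , sentence , depth , Distinguishes-sym dist
  ... | tri≈ _ cG≡cH _ = ⊥-elim (cG≢cH cG≡cH)
  ... | tri> _ _ cG>cH = count>⇒DistinguishingSentence cG cH G⇔ H⇔ inhabitedG cG>cH

-- Counting the pairs of one colour (k ≥ 3)

data Link : Set where
  identify ignore : Link

-- identifies z₃, …, z_k of a walk z₁ … z_{k+1}; its last step stays unconstrained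
chainLink : ∀ t → Fin (suc t) → Link
chainLink zero    zero    = ignore
chainLink (suc t) zero    = identify
chainLink (suc t) (suc i) = chainLink t i

chainLink-identify : ∀ t i → chainLink t i ≡ identify → toℕ i ≢ t
chainLink-identify zero    zero    ()
chainLink-identify (suc t) zero    _   ()
chainLink-identify (suc t) (suc i) eq  = chainLink-identify t i eq ∘ suc-injective

linkFormula : ∀ {k} → Link → Var k → Var k → Form k
linkFormula identify x y = x ≐ y
linkFormula ignore   x y = x ≐ x

LinkRel : ∀ {N} → Link → Fin N → Fin N → Set
LinkRel identify p q = p ≡ q
LinkRel ignore   p q = ⊤

LinkRel? : ∀ {N} l → B.Decidable (LinkRel {N} l)
LinkRel? identify = Fin._≟_
LinkRel? ignore   = λ _ _ → yes tt

Sat-linkFormula⇔ : ∀ {k} G l (a : Var k → Fin (n G)) x y → Sat G (linkFormula l x y) a ⇔ LinkRel l (a x) (a y)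
Sat-linkFormula⇔ G identify a x y = mk⇔ id id
Sat-linkFormula⇔ G ignore   a x y = mk⇔ (λ _ → tt) (λ _ → refl)

linkFormula-FreeAmong : ∀ {k} l (x y : Var k) → FreeAmong (linkFormula l x y) x y
linkFormula-FreeAmong identify x y z z∈ = z∈
linkFormula-FreeAmong ignore   x y z z∈ = inj₁ (reduce z∈)

linkFormula-WF : ∀ {k} l (x y : Var k) → WF (linkFormula l x y)
linkFormula-WF identify x y = tt
linkFormula-WF ignore   x y = tt

linkFormula-qd : ∀ {k} l (x y : Var k) {d} → qd (linkFormula l x y) ≤ d
linkFormula-qd identify x y = z≤n
linkFormula-qd ignore   x y = z≤n

walkCount-chain : ∀ {N} t (p q : Fin N) → walkCount t (LinkRel ∘ chainLink t) (LinkRel? ∘ chainLink t) p q ≡ 1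
walkCount-chain zero    p q = refl
walkCount-chain (suc t) p q =
  trans (sum-cong-≗ (λ a → trans (cong (𝟙 (p Fin.≟ a) *_) (walkCount-chain t a q)) (*-identityʳ _))) (∑-𝟙-≟ p)

module PairCount (G₁ G₂ : Graph) (t m : ℕ) where

  open ColourClasses G₁ G₂ (suc (suc t))

  module _ (r : Pair) where

    conjunct : Fin k → Form k
    conjunct zero          = suc zero ≐ suc zero
    conjunct (suc zero)    = classFormula m r (suc zero) (suc (suc zero))
    conjunct (suc (suc i)) = linkFormula (chainLink t i) (inject₁ (suc (suc i))) (suc (suc (suc i)))

    pairCountSentence : ℕ → Form k
    pairCountSentence J = ∃walk J id conjunct

    StepRel : ∀ s → Fin k → V s → V s → Set
    StepRel s zero          p q = ⊤
    StepRel s (suc zero)    p q = colour m s p q ≈[ m ] colourOf m r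
    StepRel s (suc (suc i)) p q = LinkRel (chainLink t i) p q

    StepRel? : ∀ s i → B.Decidable (StepRel s i)
    StepRel? s zero          p q = yes tt
    StepRel? s (suc zero)    p q = colour m s p q ≟[ m ] colourOf m r
    StepRel? s (suc (suc i)) p q = LinkRel? (chainLink t i) p q

    Sat-conjunct⇔ : ∀ s (a : Var k → V s) (w : Vec (V s) (suc k)) i →
                    Sat (graph s) (conjunct i) (updAll id (lookup w) a) ⇔
                    StepRel s i (lookup w (inject₁ i)) (lookup w (suc i))
    Sat-conjunct⇔ s a w zero          = mk⇔ (λ _ → tt) (λ _ → refl)
    Sat-conjunct⇔ s a w (suc zero)    =
      ⇔-resp-≡₂ (λ p q → colour m s p q ≈[ m ] colourOf m r) (at (suc zero)) (at (suc (suc zero)))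
                (Sat-classFormula⇔ m r s _ (suc zero) (suc (suc zero)) (λ ()))
      where at = updAll-injective id (lookup w) a id
    Sat-conjunct⇔ s a w (suc (suc i)) =
      ⇔-resp-≡₂ (LinkRel (chainLink t i)) (at (inject₁ (suc (suc i)))) (at (suc (suc (suc i))))
                (Sat-linkFormula⇔ (graph s) (chainLink t i) _ _ _)
      where at = updAll-injective id (lookup w) a id

    walkCount-StepRel : ∀ s u v → walkCount (suc (suc t)) (StepRel s) (StepRel? s) u v ≡ #pairs m s (colourOf m r)
    walkCount-StepRel s u v = sum-cong-≗ λ p → trans (+-identityʳ _) (sum-cong-≗ λ q →
      trans (cong (𝟙 (StepRel? s (suc zero) p q) *_) (walkCount-chain t q v)) (*-identityʳ _))

    pairCountSentence-Counts : ∀ s → Counts (graph s) pairCountSentence (#pairs m s (colourOf m r))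
    pairCountSentence-Counts s J a = ⇔-resp-≡₂ _≤_ refl (walkCount-StepRel s (a zero) (a (fromℕ k)))
      (Sat-∃walk⇔walkCount (graph s) J id conjunct a (StepRel? s) (Sat-conjunct⇔ s a))

    pairCountSentence-Sentence : ∀ J → Sentence (pairCountSentence J)
    pairCountSentence-Sentence J = ∃walk-Sentence J conjunct free interior wf
      where
      free : ∀ i → FreeAmong (conjunct i) (inject₁ i) (suc i)
      free zero          z z∈ = inj₂ (reduce z∈)
      free (suc zero)    = classFormula-FreeAmong m r (suc zero) (suc (suc zero)) (λ ())
      free (suc (suc i)) = linkFormula-FreeAmong (chainLink t i) _ _
      interior : ∀ i z → Free (conjunct i) z → Interior z
      interior zero z z∈ with refl ← reduce z∈ = Interior-suc zero (λ ())
      interior (suc zero) z z∈ with free (suc zero) z z∈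
      ... | inj₁ refl = Interior-suc zero (λ ())
      ... | inj₂ refl = Interior-suc (suc zero) (λ ())
      interior (suc (suc i)) z z∈ with chainLink t i in link≡ | z∈
      ... | identify | inj₁ refl = Interior-inject₁-suc (suc i)
      ... | identify | inj₂ refl =
        Interior-suc (suc (suc i)) (chainLink-identify t i link≡ ∘ suc-injective ∘ suc-injective)
      ... | ignore   | inj₁ refl = Interior-inject₁-suc (suc i)
      ... | ignore   | inj₂ refl = Interior-inject₁-suc (suc i)
      wf : ∀ i → WF (conjunct i)
      wf zero          = tt
      wf (suc zero)    = classFormula-WF m r (suc zero) (suc (suc zero)) (λ ())
      wf (suc (suc i)) = linkFormula-WF (chainLink t i) _ _

    pairCountSentence-qd : ∀ J → qd (pairCountSentence J) ≤ suc m
    pairCountSentence-qd J = ∃walk-qd J id conjunct λ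
      { zero          → z≤n
      ; (suc zero)    → classFormula-qd m r (suc zero) (suc (suc zero))
      ; (suc (suc i)) → linkFormula-qd (chainLink t i) _ _ }

  distinguishingSentence : WalkDistinguishes k m G₁ G₂ → DistinguishingSentence k (suc m) G₁ G₂
  distinguishingSentence dist with r , #pairs≢ ← WalkDistinguishes⇒#pairs≢ m dist =
    count≢⇒DistinguishingSentence (pairCountSentence r) m (pairCountSentence-Sentence r) (pairCountSentence-qd r)
      (#pairs m ₁ (colourOf m r)) (#pairs m ₂ (colourOf m r))
      (pairCountSentence-Counts r ₁) (pairCountSentence-Counts r ₂) (0<∑⇒Fin _) (0<∑⇒Fin _) #pairs≢

-- Counting the pairs of one colour row by row (k = 2)

module RowCount (G₁ G₂ : Graph) (m : ℕ) where

  open ColourClasses G₁ G₂ 1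

  module _ (r : Pair) where

    row : ∀ s → V s → ℕ
    row s p = ∑[ q < n (graph s) ] 𝟙 (colour m s p q ≟[ m ] colourOf m r)

    #rowsAbove : ∀ s → ℕ → ℕ
    #rowsAbove s j′ = ∑[ p < n (graph s) ] 𝟙 (j′ ≤? row s p)

    rowConjunct : Fin 2 → Form 2
    rowConjunct zero       = classFormula m r (suc zero) zero
    rowConjunct (suc zero) = zero ≐ zero

    -- in terms of the free variable z₂: at least j′ vertices q give (z₂, q) the colour of r
    rowFormula : ℕ → Form 2
    rowFormula j′ = ∃walk j′ (walkVars (suc zero) (suc (suc zero))) rowConjunct

    countConjunct : ℕ → Fin 2 → Form 2
    countConjunct j′ zero       = rowFormula j′
    countConjunct j′ (suc zero) = suc zero ≐ suc zero

    rowCountSentence : ℕ → ℕ → Form 2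
    rowCountSentence j′ J = ∃walk J id (countConjunct j′)

    RowRel : ∀ s → Fin 2 → V s → V s → Set
    RowRel s zero       p q = colour m s p q ≈[ m ] colourOf m r
    RowRel s (suc zero) p q = ⊤

    RowRel? : ∀ s i → B.Decidable (RowRel s i)
    RowRel? s zero       p q = colour m s p q ≟[ m ] colourOf m r
    RowRel? s (suc zero) p q = yes tt

    Sat-rowFormula⇔ : ∀ j′ s (a : Var 2 → V s) → Sat (graph s) (rowFormula j′) a ⇔ (j′ ≤ row s (a (suc zero)))
    Sat-rowFormula⇔ j′ s a =
      ⇔-resp-≡₂ _≤_ refl (sum-cong-≗ (λ q → *-identityʳ (𝟙 (RowRel? s zero (a (suc zero)) q))))
        (Sat-∃walk⇔walkCount (graph s) j′ xs rowConjunct a (RowRel? s) Sat-rowConjunct⇔)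
      where
      xs = walkVars (suc zero) (suc (suc zero))
      Sat-rowConjunct⇔ : ∀ w i → Sat (graph s) (rowConjunct i) (updAll xs (lookup w) a) ⇔
                                 RowRel s i (lookup w (inject₁ i)) (lookup w (suc i))
      Sat-rowConjunct⇔ w zero =
        ⇔-resp-≡₂ (λ p q → colour m s p q ≈[ m ] colourOf m r) (at zero) (at (suc zero))
                  (Sat-classFormula⇔ m r s _ (suc zero) zero (λ ()))
        where at = updAll-injective xs (lookup w) a (walkVars-injective (suc zero) (suc (suc zero)))
      Sat-rowConjunct⇔ w (suc zero) = mk⇔ (λ _ → tt) (λ _ → refl)

    CountRel : ∀ s → ℕ → Fin 2 → V s → V s → Set
    CountRel s j′ zero       p q = j′ ≤ row s q
    CountRel s j′ (suc zero) p q = ⊤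

    CountRel? : ∀ s j′ i → B.Decidable (CountRel s j′ i)
    CountRel? s j′ zero       p q = j′ ≤? row s q
    CountRel? s j′ (suc zero) p q = yes tt

    rowCountSentence-Counts : ∀ j′ s → Counts (graph s) (rowCountSentence j′) (#rowsAbove s j′)
    rowCountSentence-Counts j′ s J a =
      ⇔-resp-≡₂ _≤_ refl (sum-cong-≗ (λ p → *-identityʳ (𝟙 (CountRel? s j′ zero (a zero) p))))
        (Sat-∃walk⇔walkCount (graph s) J id (countConjunct j′) a (CountRel? s j′) Sat-countConjunct⇔)
      where
      Sat-countConjunct⇔ : ∀ w i → Sat (graph s) (countConjunct j′ i) (updAll id (lookup w) a) ⇔
                                   CountRel s j′ i (lookup w (inject₁ i)) (lookup w (suc i))
      Sat-countConjunct⇔ w zero =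
        ⇔-resp-≡₂ (λ _ q → j′ ≤ row s q) {x = lookup w zero} refl (updAll-injective id (lookup w) a id (suc zero))
                  (Sat-rowFormula⇔ j′ s (updAll id (lookup w) a))
      Sat-countConjunct⇔ w (suc zero) = mk⇔ (λ _ → tt) (λ _ → refl)

    rowFormula-free : ∀ j′ z → Free (rowFormula j′) z → z ≡ suc zero
    rowFormula-free j′ z ((zero , z∈) , not-interior) with classFormula-FreeAmong m r (suc zero) zero (λ ()) z z∈
    ... | inj₁ z≡z₂ = z≡z₂
    ... | inj₂ z≡z₁ = ⊥-elim (not-interior (suc zero , ((λ ()) , (λ ())) , z≡z₁))
    rowFormula-free j′ z ((suc zero , z∈) , not-interior) =
      ⊥-elim (not-interior (suc zero , ((λ ()) , (λ ())) , reduce z∈))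

    rowFormula-WF : ∀ j′ → WF (rowFormula j′)
    rowFormula-WF j′ = walkVars-injective (suc zero) (suc (suc zero)) , free , wf
      where
      free : ∀ i → FreeAmong (rowConjunct i) (walkVars (suc zero) (suc (suc zero)) (inject₁ i))
                                               (walkVars (suc zero) (suc (suc zero)) (suc i))
      free zero       = classFormula-FreeAmong m r (suc zero) zero (λ ())
      free (suc zero) z z∈ = inj₁ (reduce z∈)
      wf : ∀ i → WF (rowConjunct i)
      wf zero       = classFormula-WF m r (suc zero) zero (λ ())
      wf (suc zero) = tt

    rowCountSentence-Sentence : ∀ j′ J → Sentence (rowCountSentence j′ J)
    rowCountSentence-Sentence j′ J = ∃walk-Sentence J (countConjunct j′) free interior wf
      where
      free : ∀ i → FreeAmong (countConjunct j′ i) (inject₁ i) (suc i)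
      free zero       z z∈ = inj₂ (rowFormula-free j′ z z∈)
      free (suc zero) z z∈ = inj₁ (reduce z∈)
      interior : ∀ i z → Free (countConjunct j′ i) z → Interior z
      interior zero       z z∈ with refl ← rowFormula-free j′ z z∈ = (λ ()) , (λ ())
      interior (suc zero) z z∈ with refl ← reduce z∈   = (λ ()) , (λ ())
      wf : ∀ i → WF (countConjunct j′ i)
      wf zero       = rowFormula-WF j′
      wf (suc zero) = tt

    rowCountSentence-qd : ∀ j′ J → qd (rowCountSentence j′ J) ≤ suc (suc m)
    rowCountSentence-qd j′ J = ∃walk-qd J id (countConjunct j′) λ
      { zero       → ∃walk-qd j′ (walkVars (suc zero) (suc (suc zero))) rowConjunct λ
                       { zero       → classFormula-qd m r (suc zero) zero
                       ; (suc zero) → z≤n }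
      ; (suc zero) → z≤n }

    #pairs≡∑#rowsAbove : ∀ s B → n (graph s) ≤ B →
                         #pairs m s (colourOf m r) ≡ ∑[ i < B ] #rowsAbove s (suc (toℕ i))
    #pairs≡∑#rowsAbove s B n≤B = begin
      ∑[ p < n (graph s) ] row s p
        ≡⟨ sum-cong-≗ {n (graph s)} (λ p → sym (trans (∑-𝟙-suc≤? B (row s p))
                                                      (m≥n⇒m⊓n≡n (≤-trans (∑-𝟙≤ _) n≤B)))) ⟩
      ∑[ p < n (graph s) ] ∑[ i < B ] 𝟙 (suc (toℕ i) ≤? row s p)
        ≡⟨ ∑-comm {n (graph s)} {B} (λ p i → 𝟙 (suc (toℕ i) ≤? row s p)) ⟩
      ∑[ i < B ] #rowsAbove s (suc (toℕ i))
        ∎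
      where open ≡-Reasoning

    #pairs≢⇒#rowsAbove≢ : #pairs m ₁ (colourOf m r) ≢ #pairs m ₂ (colourOf m r) →
                          ∃ λ j′ → #rowsAbove ₁ j′ ≢ #rowsAbove ₂ j′
    #pairs≢⇒#rowsAbove≢ #pairs≢ =
      let i , ≢ = ∑≢⇒≢ {B} (λ i → #rowsAbove ₁ (suc (toℕ i))) (λ i → #rowsAbove ₂ (suc (toℕ i))) λ eq →
                    #pairs≢ (trans (#pairs≡∑#rowsAbove ₁ B (m≤m+n (n G₁) (n G₂)))
                                   (trans eq (sym (#pairs≡∑#rowsAbove ₂ B (m≤n+m (n G₂) (n G₁))))))
      in suc (toℕ i) , ≢
      where B = n G₁ + n G₂

  distinguishingSentence : WalkDistinguishes 2 m G₁ G₂ → DistinguishingSentence 2 (suc (suc m)) G₁ G₂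
  distinguishingSentence dist
    with r , #pairs≢ ← WalkDistinguishes⇒#pairs≢ m dist
    with j′ , #rowsAbove≢ ← #pairs≢⇒#rowsAbove≢ r #pairs≢
    = count≢⇒DistinguishingSentence (rowCountSentence r j′) (suc m) (rowCountSentence-Sentence r j′)
        (rowCountSentence-qd r j′) (#rowsAbove r ₁ j′) (#rowsAbove r ₂ j′)
        (rowCountSentence-Counts r j′ ₁) (rowCountSentence-Counts r j′ ₂) (0<∑⇒Fin _) (0<∑⇒Fin _) #rowsAbove≢

lemma14 : (k m : ℕ) → 2 ≤ k → (G₁ G₂ : Graph) →
    WalkDistinguishes k m G₁ G₂ →
    Σ (Form k) (λ φ → Sentence φ × qd φ ≡ targetDepth k m × Distinguishes φ G₁ G₂)
lemma14 (suc zero)          m (s≤s ())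
lemma14 (suc (suc zero))    m _ G₁ G₂ = RowCount.distinguishingSentence G₁ G₂ m
lemma14 (suc (suc (suc t))) m _ G₁ G₂ = PairCount.distinguishingSentence G₁ G₂ t m
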